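{- Let $V$ be a finite set, $k\ge1$, $E=[k]\times V$, and for $S\subseteq E$ let $S_i=\{v:(i,v)\in S\}$. If $\mathcal{F}=\bigcap_{j=1}^p\mathcal{I}_j$ where each $(V,\mathcal{I}_j)$ is a matroid, then $\mathcal{H}=\{S\subseteq E: S_1,\dots,S_k \text{ pairwise disjoint and } S_1\cup\cdots\cup S_k\in\mathcal{F}\}$ is the intersection of the independent-set families of $p$ matroids on $E$. -}

module Defs where

open import Data.Nat using (ℕ; _*_; _<_)
open import Data.Fin using (Fin; combine)
open import Data.Fin.Subset using (Subset; _∈_; _∉_; _∪_; ⁅_⁆; ∣_∣; _⊆_; ⊥; ⋃)
open import Data.Vec using (tabulate; lookup)
open import Data.List using (List)
import Data.List as List
open import Data.Product using (_×_; ∃-syntax)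
open import Relation.Binary.PropositionalEquality using (_≢_)
open import Relation.Nullary using (¬_)

record IsMatroid (m : ℕ) (Ind : Subset m → Set) : Set where
  field
    empty-ind : Ind ⊥
    down-closed : ∀ {A B} → A ⊆ B → Ind B → Ind A
    exchange : ∀ {A B} → Ind A → Ind B → ∣ A ∣ < ∣ B ∣ →
               ∃[ x ] (x ∈ B × x ∉ A × Ind (A ∪ ⁅ x ⁆))

record Matroid (m : ℕ) : Set₁ where
  field
    Ind : Subset m → Set
    isMatroid : IsMatroid m Ind

open Matroid public

-- The ground set E = [k] × V with V = Fin n is encoded as Fin (k * n),
-- the element (i , v) being  combine i v.
-- The slice S_i = { v : (i , v) ∈ S }.
slice : ∀ k {n} → Subset (k * n) → Fin k → Subset n
slice k S i = tabulate λ v → lookup S (combine i v)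

PairwiseDisjoint : ∀ k {n} → Subset (k * n) → Set
PairwiseDisjoint k {n} S =
  ∀ (i j : Fin k) → i ≢ j → ∀ (v : Fin n) → v ∈ slice k S i → ¬ (v ∈ slice k S j)

sliceUnion : ∀ k {n} → Subset (k * n) → Subset n
sliceUnion k S = ⋃ (List.tabulate {n = k} (slice k S))

InIntersection : ∀ {p m} → (Fin p → Matroid m) → Subset m → Set
InIntersection M S = ∀ j → Ind (M j) S

H : ∀ k {n p} → (Fin p → Matroid n) → Subset (k * n) → Set
H k M S = PairwiseDisjoint k S × InIntersection M (sliceUnion k S)

-- Replacing every element of a matroid M on V by k parallel copies gives a matroid
-- on [k] × V whose independent sets are exactly the S with pairwise disjoint slices
-- and S₁ ∪ ⋯ ∪ Sₖ independent in M: for such S the projection to V is injective, so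
-- |S| = |S₁ ∪ ⋯ ∪ Sₖ|, and the exchange axiom lifts from M by choosing any copy of the
-- element M supplies.  Taking the parallel extension of each Iⱼ gives the p matroids.
module Submission where

open import Defs
open import Data.Nat using (ℕ; zero; suc; _+_; _*_; _<_; _≥_)
open import Data.Nat.Properties using (+-suc)
open import Data.Fin using (Fin; zero; suc; combine)
open import Data.Fin.Properties using (suc-injective; combine-injectiveˡ; combine-injectiveʳ)
open import Data.Fin.Subset using (Subset; inside; outside; _∈_; _∉_; _∪_; ⁅_⁆; ∣_∣; _⊆_; ⊥; ⋃)
open import Data.Fin.Subset.Properties using (∉⊥; ∣⊥∣≡0; x∈⁅x⁆; x∈⁅y⁆⇒x≡y; x∈p∪q⁻; x∈p∪q⁺)
open import Data.Vec using ([]; _∷_; _++_; tabulate; lookup; splitAt; here; there)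
open import Data.Vec.Properties using (lookup∘tabulate; tabulate∘lookup; tabulate-cong; []=⇒lookup; lookup⇒[]=; lookup-++ˡ; lookup-++ʳ)
import Data.List as List
import Data.List.Properties as List
open import Data.Empty using (⊥-elim)
open import Data.Product using (∃-syntax; _,_; _×_; proj₁; proj₂)
open import Data.Sum using (inj₁; inj₂)
open import Function using (_∘_)
open import Function.Bundles using (_⇔_; mk⇔)
open import Relation.Binary.PropositionalEquality using (_≡_; refl; sym; trans; cong; cong₂; subst; subst₂; module ≡-Reasoning)

∈-⋃-tabulate⁻ : ∀ {k n} (f : Fin k → Subset n) {x} → x ∈ ⋃ (List.tabulate f) → ∃[ i ] x ∈ f i
∈-⋃-tabulate⁻ {zero}  f x∈⋃ = ⊥-elim (∉⊥ x∈⋃)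
∈-⋃-tabulate⁻ {suc k} f x∈⋃ with x∈p∪q⁻ (f zero) _ x∈⋃
... | inj₁ x∈f₀ = zero , x∈f₀
... | inj₂ x∈⋃′ with i , x∈fᵢ ← ∈-⋃-tabulate⁻ (λ i → f (suc i)) x∈⋃′ = suc i , x∈fᵢ

∈-⋃-tabulate⁺ : ∀ {k n} (f : Fin k → Subset n) {x} i → x ∈ f i → x ∈ ⋃ (List.tabulate f)
∈-⋃-tabulate⁺ f zero    x∈f₀ = x∈p∪q⁺ (inj₁ x∈f₀)
∈-⋃-tabulate⁺ f (suc i) x∈fᵢ =
  x∈p∪q⁺ {p = f zero} (inj₂ (∈-⋃-tabulate⁺ (λ i → f (suc i)) i x∈fᵢ))

module _ (k : ℕ) {n : ℕ} where

  ∈-slice⁻ : ∀ (S : Subset (k * n)) i {v} → v ∈ slice k S i → combine i v ∈ S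
  ∈-slice⁻ S i {v} v∈Sᵢ = lookup⇒[]= _ S (trans (sym (lookup∘tabulate _ v)) ([]=⇒lookup v∈Sᵢ))

  ∈-slice⁺ : ∀ (S : Subset (k * n)) i {v} → combine i v ∈ S → v ∈ slice k S i
  ∈-slice⁺ S i {v} iv∈S = lookup⇒[]= v _ (trans (lookup∘tabulate _ v) ([]=⇒lookup iv∈S))

  ∈-sliceUnion⁻ : ∀ (S : Subset (k * n)) {v} → v ∈ sliceUnion k S → ∃[ i ] combine {k} i v ∈ S
  ∈-sliceUnion⁻ S v∈⋃S with i , v∈Sᵢ ← ∈-⋃-tabulate⁻ (slice k S) v∈⋃S = i , ∈-slice⁻ S i v∈Sᵢ

  ∈-sliceUnion⁺ : ∀ (S : Subset (k * n)) i {v} → combine i v ∈ S → v ∈ sliceUnion k S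
  ∈-sliceUnion⁺ S i iv∈S = ∈-⋃-tabulate⁺ (slice k S) i (∈-slice⁺ S i iv∈S)

  sliceUnion-⊥ : sliceUnion k ⊥ ⊆ ⊥
  sliceUnion-⊥ v∈⋃⊥ with _ , iv∈⊥ ← ∈-sliceUnion⁻ ⊥ v∈⋃⊥ = ⊥-elim (∉⊥ iv∈⊥)

  sliceUnion-mono : ∀ {A B : Subset (k * n)} → A ⊆ B → sliceUnion k A ⊆ sliceUnion k B
  sliceUnion-mono {A} {B} A⊆B v∈⋃A with i , iv∈A ← ∈-sliceUnion⁻ A v∈⋃A =
    ∈-sliceUnion⁺ B i (A⊆B iv∈A)

  sliceUnion-∪-⁅combine⁆ : ∀ (A : Subset (k * n)) i v →
                           sliceUnion k (A ∪ ⁅ combine i v ⁆) ⊆ sliceUnion k A ∪ ⁅ v ⁆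
  sliceUnion-∪-⁅combine⁆ A i v {w} w∈⋃ with ∈-sliceUnion⁻ (A ∪ ⁅ combine i v ⁆) w∈⋃
  ... | j , jw∈A∪iv with x∈p∪q⁻ A _ jw∈A∪iv
  ...   | inj₁ jw∈A  = x∈p∪q⁺ (inj₁ (∈-sliceUnion⁺ A j jw∈A))
  ...   | inj₂ jw∈iv rewrite combine-injectiveʳ j w i v (x∈⁅y⁆⇒x≡y _ jw∈iv) =
    x∈p∪q⁺ {p = sliceUnion k A} (inj₂ (x∈⁅x⁆ v))

  PairwiseDisjoint-⊥ : PairwiseDisjoint k {n} ⊥
  PairwiseDisjoint-⊥ i _ _ _ v∈⊥ᵢ _ = ∉⊥ (∈-slice⁻ ⊥ i v∈⊥ᵢ)

  PairwiseDisjoint-anti : ∀ {A B : Subset (k * n)} → A ⊆ B →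
                          PairwiseDisjoint k B → PairwiseDisjoint k A
  PairwiseDisjoint-anti {A} {B} A⊆B disjB i j i≢j v v∈Aᵢ v∈Aⱼ =
    disjB i j i≢j v (∈-slice⁺ B i (A⊆B (∈-slice⁻ A i v∈Aᵢ)))
                    (∈-slice⁺ B j (A⊆B (∈-slice⁻ A j v∈Aⱼ)))

  PairwiseDisjoint-∪-⁅combine⁆ : ∀ {A : Subset (k * n)} i {v} → v ∉ sliceUnion k A →
                                 PairwiseDisjoint k A → PairwiseDisjoint k (A ∪ ⁅ combine i v ⁆)
  PairwiseDisjoint-∪-⁅combine⁆ {A} i {v} v∉⋃A disjA j l j≢l w w∈ⱼ w∈ₗ
    with x∈p∪q⁻ A _ (∈-slice⁻ _ j w∈ⱼ) | x∈p∪q⁻ A _ (∈-slice⁻ _ l w∈ₗ)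
  ... | inj₁ jw∈A  | inj₁ lw∈A  = disjA j l j≢l w (∈-slice⁺ A j jw∈A) (∈-slice⁺ A l lw∈A)
  ... | inj₂ jw≡iv | inj₂ lw≡iv =
    j≢l (trans (combine-injectiveˡ j w i v (x∈⁅y⁆⇒x≡y _ jw≡iv))
               (sym (combine-injectiveˡ l w i v (x∈⁅y⁆⇒x≡y _ lw≡iv))))
  ... | inj₂ jw≡iv | inj₁ lw∈A
    rewrite combine-injectiveʳ j w i v (x∈⁅y⁆⇒x≡y _ jw≡iv) = v∉⋃A (∈-sliceUnion⁺ A l lw∈A)
  ... | inj₁ jw∈A  | inj₂ lw≡iv
    rewrite combine-injectiveʳ l w i v (x∈⁅y⁆⇒x≡y _ lw≡iv) = v∉⋃A (∈-sliceUnion⁺ A j jw∈A)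

∣p++q∣≡∣p∣+∣q∣ : ∀ {a b} (p : Subset a) (q : Subset b) → ∣ p ++ q ∣ ≡ ∣ p ∣ + ∣ q ∣
∣p++q∣≡∣p∣+∣q∣ []            q = refl
∣p++q∣≡∣p∣+∣q∣ (inside  ∷ p) q = cong suc (∣p++q∣≡∣p∣+∣q∣ p q)
∣p++q∣≡∣p∣+∣q∣ (outside ∷ p) q = ∣p++q∣≡∣p∣+∣q∣ p q

∣p∪q∣≡∣p∣+∣q∣ : ∀ {n} (p q : Subset n) → (∀ {x} → x ∈ p → x ∉ q) → ∣ p ∪ q ∣ ≡ ∣ p ∣ + ∣ q ∣
∣p∪q∣≡∣p∣+∣q∣ []            []            _    = refl
∣p∪q∣≡∣p∣+∣q∣ (inside  ∷ p) (inside  ∷ q) disj = ⊥-elim (disj here here)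
∣p∪q∣≡∣p∣+∣q∣ (inside  ∷ p) (outside ∷ q) disj =
  cong suc (∣p∪q∣≡∣p∣+∣q∣ p q λ x∈p x∈q → disj (there x∈p) (there x∈q))
∣p∪q∣≡∣p∣+∣q∣ (outside ∷ p) (inside  ∷ q) disj =
  trans (cong suc (∣p∪q∣≡∣p∣+∣q∣ p q λ x∈p x∈q → disj (there x∈p) (there x∈q))) (sym (+-suc _ _))
∣p∪q∣≡∣p∣+∣q∣ (outside ∷ p) (outside ∷ q) disj =
  ∣p∪q∣≡∣p∣+∣q∣ p q λ x∈p x∈q → disj (there x∈p) (there x∈q)

module _ {k n : ℕ} (p : Subset n) (q : Subset (k * n)) where

  slice-++-zero : slice (suc k) (p ++ q) zero ≡ p
  slice-++-zero = trans (tabulate-cong (lookup-++ˡ p q)) (tabulate∘lookup p)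

  slice-++-suc : ∀ i → slice (suc k) (p ++ q) (suc i) ≡ slice k q i
  slice-++-suc i = tabulate-cong (λ v → lookup-++ʳ p q (combine i v))

  sliceUnion-++ : sliceUnion (suc k) (p ++ q) ≡ p ∪ sliceUnion k q
  sliceUnion-++ = cong₂ _∪_ slice-++-zero (cong ⋃ (List.tabulate-cong slice-++-suc))

  PairwiseDisjoint-++⁻ : PairwiseDisjoint (suc k) (p ++ q) →
                         PairwiseDisjoint k q × (∀ {v} → v ∈ p → v ∉ sliceUnion k q)
  PairwiseDisjoint-++⁻ disj = disjq , disjp
    where
    ∈-slice-suc : ∀ {i v} → v ∈ slice k q i → v ∈ slice (suc k) (p ++ q) (suc i)
    ∈-slice-suc {i} {v} = subst (v ∈_) (sym (slice-++-suc i))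

    disjq : PairwiseDisjoint k q
    disjq i j i≢j v v∈qᵢ v∈qⱼ =
      disj (suc i) (suc j) (i≢j ∘ suc-injective) v (∈-slice-suc v∈qᵢ) (∈-slice-suc v∈qⱼ)

    disjp : ∀ {v} → v ∈ p → v ∉ sliceUnion k q
    disjp {v} v∈p v∈⋃q with i , v∈qᵢ ← ∈-⋃-tabulate⁻ (slice k q) v∈⋃q =
      disj zero (suc i) (λ ()) v (subst (v ∈_) (sym slice-++-zero) v∈p) (∈-slice-suc v∈qᵢ)

∣S∣≡∣sliceUnion∣ : ∀ k {n} (S : Subset (k * n)) → PairwiseDisjoint k S → ∣ S ∣ ≡ ∣ sliceUnion k S ∣
∣S∣≡∣sliceUnion∣ zero    {n} [] _    = sym (∣⊥∣≡0 n)
∣S∣≡∣sliceUnion∣ (suc k) {n} S  disj with splitAt n S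
... | p , q , refl with disjq , disjp ← PairwiseDisjoint-++⁻ p q disj = begin
  ∣ p ++ q ∣                      ≡⟨ ∣p++q∣≡∣p∣+∣q∣ p q ⟩
  ∣ p ∣ + ∣ q ∣                   ≡⟨ cong (∣ p ∣ +_) (∣S∣≡∣sliceUnion∣ k q disjq) ⟩
  ∣ p ∣ + ∣ sliceUnion k q ∣      ≡⟨ ∣p∪q∣≡∣p∣+∣q∣ p (sliceUnion k q) disjp ⟨
  ∣ p ∪ sliceUnion k q ∣          ≡⟨ cong ∣_∣ (sliceUnion-++ {k} p q) ⟨
  ∣ sliceUnion (suc k) (p ++ q) ∣ ∎
  where open ≡-Reasoning

ParallelInd : ∀ {n} k → Matroid n → Subset (k * n) → Set
ParallelInd k M S = PairwiseDisjoint k S × Ind M (sliceUnion k S)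

parallel-isMatroid : ∀ {n} k (M : Matroid n) → IsMatroid (k * n) (ParallelInd k M)
parallel-isMatroid k M = record
  { empty-ind   = PairwiseDisjoint-⊥ k , down-closed (sliceUnion-⊥ k) empty-ind
  ; down-closed = λ A⊆B (disjB , indB) →
      PairwiseDisjoint-anti k A⊆B disjB , down-closed (sliceUnion-mono k A⊆B) indB
  ; exchange    = parallel-exchange
  }
  where
  open IsMatroid (isMatroid M)

  parallel-exchange : ∀ {A B} → ParallelInd k M A → ParallelInd k M B → ∣ A ∣ < ∣ B ∣ →
                      ∃[ x ] (x ∈ B × x ∉ A × ParallelInd k M (A ∪ ⁅ x ⁆))
  parallel-exchange {A} {B} (disjA , indA) (disjB , indB) ∣A∣<∣B∣
    with v , v∈⋃B , v∉⋃A , indA+v ←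
           exchange indA indB
             (subst₂ _<_ (∣S∣≡∣sliceUnion∣ k A disjA) (∣S∣≡∣sliceUnion∣ k B disjB) ∣A∣<∣B∣)
    with i , iv∈B ← ∈-sliceUnion⁻ k B v∈⋃B =
    combine i v , iv∈B , (λ iv∈A → v∉⋃A (∈-sliceUnion⁺ k A i iv∈A)) ,
    PairwiseDisjoint-∪-⁅combine⁆ k {A = A} i v∉⋃A disjA ,
    down-closed (sliceUnion-∪-⁅combine⁆ k A i v) indA+v

parallel : ∀ {n} k → Matroid n → Matroid (k * n)
parallel k M = record { Ind = ParallelInd k M ; isMatroid = parallel-isMatroid k M }

corollary2 : (n k p : ℕ) → k ≥ 1 → p ≥ 1 → (M : Fin p → Matroid n) →
    ∃[ M′ ] (∀ (S : Subset (k * n)) → H k M S ⇔ InIntersection {p} M′ S)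
corollary2 n k zero    _ () M
corollary2 n k (suc p) _ _  M = (λ j → parallel k (M j)) , λ S → mk⇔
  (λ (disj , ind) j → disj , ind j)
  (λ ind → proj₁ (ind zero) , λ j → proj₂ (ind j))
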